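{- Let $M$ be a DFA with $n$ states. If $L(M)$ is not prefix-convex, then there exists a witness $(u,v,w)$ to the failure of prefix-convexity with $|w| \le 2n - 1$. Furthermore, this bound is best possible: for every $n \ge 2$ there exists a DFA with $n$ states over a one-letter alphabet whose language is not prefix-convex and for which every witness $(u,v,w)$ satisfies $|w| \ge 2n-1$.
   Context: A word $u$ is a prefix of $v$ if $v = ux$ for some word $x$. A witness to the failure of prefix-convexity of $L$ is a triple $(u,v,w)$ with $u,w \in L$, $v \notin L$, $u$ a prefix of $v$ and $v$ a prefix of $w$. $L$ is prefix-convex iff no witness exists. -}

module Defs where

open import Data.Nat using (ℕ)
open import Data.Fin using (Fin)
open import Data.Bool using (Bool; true; false)
open import Data.List using (List; foldl; _++_)
open import Data.Product using (Σ; ∃; _×_)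
open import Relation.Binary.PropositionalEquality using (_≡_)
open import Relation.Nullary using (¬_)

record DFA (n k : ℕ) : Set where
  field
    δ      : Fin n → Fin k → Fin n
    start  : Fin n
    final  : Fin n → Bool

Word : ℕ → Set
Word k = List (Fin k)

δ* : ∀ {n k} → DFA n k → Fin n → Word k → Fin n
δ* M q w = foldl (DFA.δ M) q w

_∈L_ : ∀ {n k} → Word k → DFA n k → Set
w ∈L M = DFA.final M (δ* M (DFA.start M) w) ≡ true

IsPrefix : ∀ {k} → Word k → Word k → Set
IsPrefix {k} u v = Σ (Word k) λ x → v ≡ u ++ x

record Witness {n k : ℕ} (M : DFA n k) (u v w : Word k) : Set where
  field
    u∈L   : u ∈L M
    v∉L   : ¬ (v ∈L M)
    w∈L   : w ∈L M
    u≤v   : IsPrefix u v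
    v≤w   : IsPrefix v w

PrefixConvex : ∀ {n k} → DFA n k → Set
PrefixConvex {n} {k} M = ∀ (u v w : Word k) → ¬ Witness M u v w

-- Upper bound: on any witness (u, u x, u x z) follow x letter by letter from u until
-- the automaton first leaves the accepting states, say after u x₁ a.  Replacing u x₁
-- and the remaining suffix by words of length < n reaching the same states (a loop
-- can be cut out of any word of length ≥ n, by pigeonhole) gives a witness
-- (u', u' a, u' a y') of length at most (n - 1) + 1 + (n - 1).  Such short witnesses
-- range over a finite set, so their existence is decidable, which turns the
-- double negation ¬ PrefixConvex M into an actual witness.
--
-- Lower bound: the n-cycle accepting exactly the words of length ≡ n - 1 (mod n).
-- In a witness u is a proper prefix of w, both accepted, so their lengths are
-- distinct and congruent modulo n; hence |w| ≥ (n - 1) + n.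
module Submission where

open import Defs
open import Data.Nat using (ℕ; _≤_; _∸_; _*_; _≥_)
open import Data.List using (length)
open import Data.Product using (_×_; Σ; ∃)
open import Relation.Nullary using (¬_)

open import Data.Bool using (true)
open import Data.Bool.Properties using (T-≡) renaming (_≟_ to _≟ᵇ_)
open import Data.Empty using (⊥-elim)
open import Data.Fin as Fin using (Fin; toℕ)
open import Data.Fin.Properties using (pigeonhole; any?; toℕ<n; toℕ-fromℕ<)
open import Data.List using ([]; _∷_; _++_; [_]; _∷ʳ_; take; drop; replicate)
open import Data.List.Properties
  using (foldl-++; length-++; length-++-≤ˡ; length-++-sucʳ; length-take; length-drop;
         take++drop≡id; length-replicate; ++-identityʳ)
open import Data.Nat using (zero; suc; _+_; _<_; _⊓_; _%_; _/_; _≡ᵇ_; s≤s; z<s; s<s; NonZero; _<?_; s≤s⁻¹; ≢-nonZero⁻¹)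
open import Data.Nat.DivMod using (_mod_; m%n<n; %-distribˡ-+; m%n%n≡m%n; m≡m%n+[m/n]*n; m%n≤m; m<n⇒m%n≡m; n%n≡0; [m+n]%n≡m%n)
open import Data.Nat.Induction using (<-wellFounded)
open import Data.Nat.Properties
open import Data.Product using (_,_; ∃-syntax)
open import Function using (_∘_; _⇔_; mk⇔; Equivalence)
open import Induction.WellFounded using (Acc; acc)
open import Relation.Binary.PropositionalEquality using (_≡_; _≢_; refl; sym; trans; cong; cong₂; subst; module ≡-Reasoning)
open import Relation.Nullary using (Dec; yes; no; ¬?)
open import Relation.Nullary.Decidable using (_×-dec_; decidable-stable)

m<n⇒m≤n∸1 : ∀ {m n} → m < n → m ≤ n ∸ 1
m<n⇒m≤n∸1 (s≤s m≤n) = m≤n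

m<n⇒o<n⇒m+1+o≤2*n∸1 : ∀ {m n o} → m < n → o < n → m + 1 + o ≤ 2 * n ∸ 1
m<n⇒o<n⇒m+1+o≤2*n∸1 {m} {n} {o} m<n o<n = m<n⇒m≤n∸1 (begin-strict
  m + 1 + o  ≡⟨ cong (_+ o) (+-comm m 1) ⟩
  suc m + o  <⟨ +-mono-≤-< m<n o<n ⟩
  n + n      ≡⟨ cong (n +_) (+-identityʳ n) ⟨
  2 * n      ∎)
  where open ≤-Reasoning

[m%n+o]%n≡[m+o]%n : ∀ m o n .{{_ : NonZero n}} → (m % n + o) % n ≡ (m + o) % n
[m%n+o]%n≡[m+o]%n m o n = begin
  (m % n + o) % n          ≡⟨ %-distribˡ-+ (m % n) o n ⟩
  (m % n % n + o % n) % n  ≡⟨ cong (λ r → (r + o % n) % n) (m%n%n≡m%n m n) ⟩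
  (m % n + o % n) % n      ≡⟨ %-distribˡ-+ m o n ⟨
  (m + o) % n              ∎
  where open ≡-Reasoning

m%n≡o%n⇒m<o⇒o%n+n≤o : ∀ {m o n} .{{_ : NonZero n}} → m % n ≡ o % n → m < o → o % n + n ≤ o
m%n≡o%n⇒m<o⇒o%n+n≤o {m} {o} {n} m≡o m<o with o / n | m≡m%n+[m/n]*n o n
... | zero  | o≡ = ⊥-elim (<-irrefl refl (begin-strict
  o          ≡⟨ o≡ ⟩
  o % n + 0  ≡⟨ +-identityʳ (o % n) ⟩
  o % n      ≡⟨ m≡o ⟨
  m % n      ≤⟨ m%n≤m m n ⟩
  m          <⟨ m<o ⟩
  o          ∎))
  where open ≤-Reasoning
... | suc q | o≡ = begin
  o % n + n            ≤⟨ +-monoʳ-≤ (o % n) (m≤m+n n (q * n)) ⟩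
  o % n + (n + q * n)  ≡⟨ o≡ ⟨
  o                    ∎
  where open ≤-Reasoning

prefix-length-≤ : ∀ {k} {u v : Word k} → IsPrefix u v → length u ≤ length v
prefix-length-≤ {u = u} (_ , refl) = length-++-≤ˡ u

proper-prefix-length-< : ∀ {k} {u v : Word k} → IsPrefix u v → u ≢ v → length u < length v
proper-prefix-length-< {u = u} ([] , refl) u≢v = ⊥-elim (u≢v (sym (++-identityʳ u)))
proper-prefix-length-< {u = u} (a ∷ x , refl) _ =
  ≤-trans (s≤s (length-++-≤ˡ u)) (≤-reflexive (sym (length-++-sucʳ u a x)))

∃-length<? : ∀ {k} (P : Word k → Set) m → (∀ w → Dec (P w)) → Dec (∃[ w ] length w < m × P w)
∃-length<? P zero    P? = no λ ()
∃-length<? P (suc m) P? with P? []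
... | yes p = yes ([] , z<s , p)
... | no ¬p with any? (λ a → ∃-length<? (P ∘ (a ∷_)) m (P? ∘ (a ∷_)))
...   | yes (a , w , w<m , p) = yes (a ∷ w , s<s w<m , p)
...   | no ¬q = no λ { ([] , _ , p) → ¬p p ; (a ∷ w , s<s w<m , p) → ¬q (a , w , w<m , p) }

module _ {n k : ℕ} (M : DFA n k) where
  open DFA M

  Accepting : Fin n → Set
  Accepting q = final q ≡ true

  accepting? : ∀ q → Dec (Accepting q)
  accepting? q = final q ≟ᵇ true

  δ*-++ : ∀ q x y → δ* M q (x ++ y) ≡ δ* M (δ* M q x) y
  δ*-++ = foldl-++ δ

  witness-length-< : ∀ {u v w} → Witness M u v w → length u < length w
  witness-length-< W = <-≤-trans (proper-prefix-length-< u≤v λ { refl → v∉L u∈L }) (prefix-length-≤ v≤w)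
    where open Witness W

  loop-removal : ∀ q x → n ≤ length x → ∃[ x' ] length x' < length x × δ* M q x' ≡ δ* M q x
  loop-removal q x n≤∣x∣ with pigeonhole (n<1+n n) (λ i → δ* M q (take (toℕ i) x))
  ... | i , j , i<j , same = take (toℕ i) x ++ drop (toℕ j) x , shorter , sameState
    where
    j≤∣x∣ : toℕ j ≤ length x
    j≤∣x∣ = ≤-trans (s≤s⁻¹ (toℕ<n j)) n≤∣x∣

    shorter : length (take (toℕ i) x ++ drop (toℕ j) x) < length x
    shorter = begin-strict
      length (take (toℕ i) x ++ drop (toℕ j) x)       ≡⟨ length-++ (take (toℕ i) x) ⟩
      length (take (toℕ i) x) + length (drop (toℕ j) x)
                                 ≡⟨ cong₂ _+_ (length-take (toℕ i) x) (length-drop (toℕ j) x) ⟩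
      toℕ i ⊓ length x + (length x ∸ toℕ j)           ≤⟨ +-monoˡ-≤ _ (m⊓n≤m (toℕ i) (length x)) ⟩
      toℕ i + (length x ∸ toℕ j)                      <⟨ +-monoˡ-< _ i<j ⟩
      toℕ j + (length x ∸ toℕ j)                      ≡⟨ m+[n∸m]≡n j≤∣x∣ ⟩
      length x                                        ∎
      where open ≤-Reasoning

    sameState : δ* M q (take (toℕ i) x ++ drop (toℕ j) x) ≡ δ* M q x
    sameState = begin
      δ* M q (take (toℕ i) x ++ drop (toℕ j) x)      ≡⟨ δ*-++ q (take (toℕ i) x) (drop (toℕ j) x) ⟩
      δ* M (δ* M q (take (toℕ i) x)) (drop (toℕ j) x) ≡⟨ cong (λ p → δ* M p (drop (toℕ j) x)) same ⟩
      δ* M (δ* M q (take (toℕ j) x)) (drop (toℕ j) x) ≡⟨ δ*-++ q (take (toℕ j) x) (drop (toℕ j) x) ⟨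
      δ* M q (take (toℕ j) x ++ drop (toℕ j) x)      ≡⟨ cong (δ* M q) (take++drop≡id (toℕ j) x) ⟩
      δ* M q x                                       ∎
      where open ≡-Reasoning

  reach-by-length< : ∀ q x → ∃[ x' ] length x' < n × δ* M q x' ≡ δ* M q x
  reach-by-length< q x = go x (<-wellFounded (length x))
    where
    go : ∀ x → Acc _<_ (length x) → ∃[ x' ] length x' < n × δ* M q x' ≡ δ* M q x
    go x (acc rs) with length x <? n
    ... | yes ∣x∣<n = x , ∣x∣<n , refl
    ... | no ∣x∣≮n with x' , shorter , same ← loop-removal q x (≮⇒≥ ∣x∣≮n)
                   with x'' , short , same' ← go x' (rs shorter)
                   = x'' , short , trans same' same

  first-exit : ∀ q x → Accepting q → ¬ Accepting (δ* M q x) →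
    ∃[ x₁ ] ∃[ a ] ∃[ x₂ ] x ≡ x₁ ++ a ∷ x₂ × Accepting (δ* M q x₁) × ¬ Accepting (δ (δ* M q x₁) a)
  first-exit q []      accept reject = ⊥-elim (reject accept)
  first-exit q (b ∷ x) accept reject with accepting? (δ q b)
  ... | no  reject₁ = [] , b , x , refl , accept , reject₁
  ... | yes accept₁ with x₁ , a , x₂ , refl , accept₂ , reject₂ ← first-exit (δ q b) x accept₁ reject
                    = b ∷ x₁ , a , x₂ , refl , accept₂ , reject₂

  Dip : Fin n → Fin k → Word k → Set
  Dip p a y = Accepting p × ¬ Accepting (δ p a) × Accepting (δ* M (δ p a) y)

  ShortDip : Set
  ShortDip = ∃[ u ] length u < n × ∃[ a ] ∃[ y ] length y < n × Dip (δ* M start u) a y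

  shortDip? : Dec ShortDip
  shortDip? = ∃-length<? _ n λ u → any? λ a → ∃-length<? _ n λ y → dip? (δ* M start u) a y
    where
    dip? : ∀ p a y → Dec (Dip p a y)
    dip? p a y = accepting? p ×-dec ¬? (accepting? (δ p a)) ×-dec accepting? (δ* M (δ p a) y)

  dip⇒witness : ∀ u a y → Dip (δ* M start u) a y → Witness M u (u ∷ʳ a) (u ∷ʳ a ++ y)
  dip⇒witness u a y (accept , reject , accept′) = record
    { u∈L = accept
    ; v∉L = reject ∘ subst Accepting (δ*-++ start u [ a ])
    ; w∈L = subst Accepting (sym (trans (δ*-++ start (u ∷ʳ a) y) (cong (λ q → δ* M q y) (δ*-++ start u [ a ]))))
                  accept′
    ; u≤v = [ a ] , refl
    ; v≤w = y , refl
    }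

  witness⇒shortDip : ∀ {u v w} → Witness M u v w → ShortDip
  witness⇒shortDip {u} record { u∈L = u∈L ; v∉L = v∉L ; w∈L = w∈L ; u≤v = x , refl ; v≤w = z , refl }
    with x₁ , a , x₂ , refl , accept , reject
           ← first-exit (δ* M start u) x u∈L (v∉L ∘ subst Accepting (sym (δ*-++ start u x)))
    with u' , u'<n , u'≡ ← reach-by-length< start (u ++ x₁)
    with y' , y'<n , y'≡ ← reach-by-length< (δ (δ* M (δ* M start u) x₁) a) (x₂ ++ z)
    = u' , u'<n , a , y' , y'<n ,
      subst (λ q → Dip q a y') (sym (trans u'≡ (δ*-++ start u x₁)))
        (accept , reject , subst Accepting (trans returns (sym y'≡)) w∈L)
    where
    p : Fin n
    p = δ* M (δ* M start u) x₁

    returns : δ* M start ((u ++ (x₁ ++ a ∷ x₂)) ++ z) ≡ δ* M (δ p a) (x₂ ++ z)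
    returns = begin
      δ* M start ((u ++ (x₁ ++ a ∷ x₂)) ++ z)         ≡⟨ δ*-++ start (u ++ (x₁ ++ a ∷ x₂)) z ⟩
      δ* M (δ* M start (u ++ (x₁ ++ a ∷ x₂))) z       ≡⟨ cong (λ q → δ* M q z) (δ*-++ start u (x₁ ++ a ∷ x₂)) ⟩
      δ* M (δ* M (δ* M start u) (x₁ ++ a ∷ x₂)) z     ≡⟨ cong (λ q → δ* M q z) (δ*-++ (δ* M start u) x₁ (a ∷ x₂)) ⟩
      δ* M (δ* M (δ p a) x₂) z                        ≡⟨ δ*-++ (δ p a) x₂ z ⟨
      δ* M (δ p a) (x₂ ++ z)                          ∎
      where open ≡-Reasoning

  shortDip⇒witness : ShortDip → ∃[ u ] ∃[ v ] ∃[ w ] Witness M u v w × length w ≤ 2 * n ∸ 1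
  shortDip⇒witness (u , u<n , a , y , y<n , dip) =
    u , u ∷ʳ a , u ∷ʳ a ++ y , dip⇒witness u a y dip ,
    subst (_≤ 2 * n ∸ 1) (sym ∣w∣) (m<n⇒o<n⇒m+1+o≤2*n∸1 u<n y<n)
    where
    ∣w∣ : length (u ∷ʳ a ++ y) ≡ length u + 1 + length y
    ∣w∣ = trans (length-++ (u ∷ʳ a)) (cong (_+ length y) (length-++ u))

  short-witness : ¬ PrefixConvex M → ∃[ u ] ∃[ v ] ∃[ w ] Witness M u v w × length w ≤ 2 * n ∸ 1
  short-witness ¬convex = shortDip⇒witness (decidable-stable shortDip? λ ¬dip →
    ¬convex λ _ _ _ W → ¬dip (witness⇒shortDip W))

cycle : (N : ℕ) → DFA (suc N) 1
cycle N = record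
  { δ     = λ q _ → suc (toℕ q) mod suc N
  ; start = Fin.zero
  ; final = λ q → toℕ q ≡ᵇ N
  }

module _ (N : ℕ) where

  toℕ-δ*-cycle : ∀ q w → toℕ (δ* (cycle N) q w) ≡ (toℕ q + length w) % suc N
  toℕ-δ*-cycle q [] = sym (trans (cong (_% suc N) (+-identityʳ (toℕ q))) (m<n⇒m%n≡m (toℕ<n q)))
  toℕ-δ*-cycle q (_ ∷ w) = begin
    toℕ (δ* (cycle N) (suc (toℕ q) mod suc N) w)         ≡⟨ toℕ-δ*-cycle (suc (toℕ q) mod suc N) w ⟩
    (toℕ (suc (toℕ q) mod suc N) + length w) % suc N
      ≡⟨ cong (λ r → (r + length w) % suc N) (toℕ-fromℕ< (m%n<n (suc (toℕ q)) (suc N))) ⟩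
    (suc (toℕ q) % suc N + length w) % suc N             ≡⟨ [m%n+o]%n≡[m+o]%n (suc (toℕ q)) (length w) (suc N) ⟩
    (suc (toℕ q) + length w) % suc N                     ≡⟨ cong (_% suc N) (+-suc (toℕ q) (length w)) ⟨
    (toℕ q + suc (length w)) % suc N                     ∎
    where open ≡-Reasoning

  ∈L-cycle⇔ : ∀ w → w ∈L cycle N ⇔ length w % suc N ≡ N
  ∈L-cycle⇔ w = mk⇔
    (λ w∈L → trans (sym (toℕ-δ*-cycle Fin.zero w)) (≡ᵇ⇒≡ _ N (Equivalence.from T-≡ w∈L)))
    (λ ∣w∣≡ → Equivalence.to T-≡ (≡⇒≡ᵇ _ N (trans (toℕ-δ*-cycle Fin.zero w) ∣w∣≡)))

  cycle-not-prefixConvex : .{{NonZero N}} → ¬ PrefixConvex (cycle N)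
  cycle-not-prefixConvex convex = convex u v (v ++ u) record
    { u∈L = Equivalence.from (∈L-cycle⇔ u) ∣u∣%n
    ; v∉L = λ v∈L → ≢-nonZero⁻¹ N (trans (sym (Equivalence.to (∈L-cycle⇔ v) v∈L)) ∣v∣%n)
    ; w∈L = Equivalence.from (∈L-cycle⇔ (v ++ u)) ∣w∣%n
    ; u≤v = [ Fin.zero ] , refl
    ; v≤w = u , refl
    }
    where
    u v : Word 1
    u = replicate N Fin.zero
    v = u ∷ʳ Fin.zero

    ∣u∣ : length u ≡ N
    ∣u∣ = length-replicate N

    ∣v∣ : length v ≡ suc N
    ∣v∣ = trans (length-++ u) (trans (cong (_+ 1) ∣u∣) (+-comm N 1))

    ∣u∣%n : length u % suc N ≡ N
    ∣u∣%n = trans (cong (_% suc N) ∣u∣) (m<n⇒m%n≡m (n<1+n N))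

    ∣v∣%n : length v % suc N ≡ 0
    ∣v∣%n = trans (cong (_% suc N) ∣v∣) (n%n≡0 (suc N))

    ∣w∣%n : length (v ++ u) % suc N ≡ N
    ∣w∣%n = begin
      length (v ++ u) % suc N      ≡⟨ cong (_% suc N) (trans (length-++ v) (cong₂ _+_ ∣v∣ ∣u∣)) ⟩
      (suc N + N) % suc N          ≡⟨ cong (_% suc N) (+-comm (suc N) N) ⟩
      (N + suc N) % suc N          ≡⟨ [m+n]%n≡m%n N (suc N) ⟩
      N % suc N                    ≡⟨ m<n⇒m%n≡m (n<1+n N) ⟩
      N                            ∎
      where open ≡-Reasoning

  cycle-witness-length : ∀ {u v w} → Witness (cycle N) u v w → 2 * suc N ∸ 1 ≤ length w
  cycle-witness-length {u} {v} {w} W = begin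
    2 * suc N ∸ 1             ≡⟨ cong (N +_) (+-identityʳ (suc N)) ⟩
    N + suc N                 ≡⟨ cong (_+ suc N) ∣w∣%n ⟨
    length w % suc N + suc N  ≤⟨ m%n≡o%n⇒m<o⇒o%n+n≤o (trans ∣u∣%n (sym ∣w∣%n)) (witness-length-< (cycle N) W) ⟩
    length w                  ∎
    where
    open ≤-Reasoning

    ∣u∣%n : length u % suc N ≡ N
    ∣u∣%n = Equivalence.to (∈L-cycle⇔ u) (Witness.u∈L W)

    ∣w∣%n : length w % suc N ≡ N
    ∣w∣%n = Equivalence.to (∈L-cycle⇔ w) (Witness.w∈L W)

theorem10 : (∀ (n k : ℕ) (M : DFA n k) → ¬ PrefixConvex M →
    Σ (Word k) λ u → Σ (Word k) λ v → Σ (Word k) λ w →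
    Witness M u v w × length w ≤ 2 * n ∸ 1)
    × (∀ (n : ℕ) → n ≥ 2 →
    Σ (DFA n 1) λ M → ¬ PrefixConvex M
    × (∀ (u v w : Word 1) → Witness M u v w → length w ≥ 2 * n ∸ 1))
theorem10 = (λ n k → short-witness) , optimal
  where
  optimal : ∀ (n : ℕ) → n ≥ 2 → Σ (DFA n 1) λ M → ¬ PrefixConvex M
    × (∀ (u v w : Word 1) → Witness M u v w → length w ≥ 2 * n ∸ 1)
  optimal (suc zero) (s≤s ())
  optimal (suc (suc N)) _ =
    cycle (suc N) , cycle-not-prefixConvex (suc N) , λ _ _ _ → cycle-witness-length (suc N)
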